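{- For every positive integer $n$, \[\mathcal{I}_3(n)=\sum_{k=0}^{\lfloor\frac{n+1}{2}\rfloor}\left[\binom{n-k+1}{k}+\binom{n-k}{k-1}\right]2^{n-2k},\] with the convention $\binom{r}{ -1}=0$.
   Context: $\mathcal{I}_3(n)$ is the number of sequences $(r_1,\dots,r_n)$ with $r_i\in\{1,2,3\}$ and $|r_{i+1}-r_i|\le1$ for all $i$ (lattice paths with steps $(1,0),(1,1),(1,-1)$ from the first to the last column of the table with $3$ rows and $n$ columns, staying inside). -}

module Defs where

open import Data.Nat using (ℕ; zero; suc; _+_; _*_; _∸_; _^_; _≤_)
open import Data.Nat.Combinatorics using (_C_)
open import Data.Fin using (Fin; toℕ)
open import Data.Vec using (Vec; []; _∷_)
open import Data.List using (List; []; _∷_; length; filter; map; concatMap; sum; upTo)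
open import Data.Integer using (ℤ; +_; -[1+_])
import Data.Integer as ℤ
open import Data.Rational using (ℚ)
import Data.Rational as ℚ
open import Data.Product using (_×_)
open import Data.Unit using (⊤)
open import Relation.Nullary using (Dec; yes; no)
open import Relation.Nullary.Decidable using (_×-dec_)
open import Relation.Unary using (Decidable)
import Data.Nat as ℕ
import Data.Nat.Properties as ℕₚ

-- The rows 1,2,3 are represented by Fin 3 (values 0,1,2).
-- |a - b| ≤ 1, with a, b read as natural numbers.
Adjacent : Fin 3 → Fin 3 → Set
Adjacent a b = (toℕ a ≤ toℕ b + 1) × (toℕ b ≤ toℕ a + 1)

adjacent? : (a b : Fin 3) → Dec (Adjacent a b)
adjacent? a b = (toℕ a ℕ.≤? toℕ b + 1) ×-dec (toℕ b ℕ.≤? toℕ a + 1)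

data Admissible : {n : ℕ} → Vec (Fin 3) n → Set where
  adm[] : Admissible []
  adm[x] : (a : Fin 3) → Admissible (a ∷ [])
  adm∷ : {n : ℕ} (a b : Fin 3) (v : Vec (Fin 3) n) →
         Adjacent a b → Admissible (b ∷ v) → Admissible (a ∷ b ∷ v)

admissible? : {n : ℕ} → (v : Vec (Fin 3) n) → Dec (Admissible v)
admissible? [] = yes adm[]
admissible? (a ∷ []) = yes (adm[x] a)
admissible? (a ∷ b ∷ v) with adjacent? a b | admissible? (b ∷ v)
... | yes p | yes q = yes (adm∷ a b v p q)
... | no ¬p | _ = no λ { (adm∷ _ _ _ p _) → ¬p p }
... | yes _ | no ¬q = no λ { (adm∷ _ _ _ _ q) → ¬q q }

fin3 : List (Fin 3)
fin3 = Fin.zero ∷ Fin.suc Fin.zero ∷ Fin.suc (Fin.suc Fin.zero) ∷ []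
  where import Data.Fin as Fin

allSeqs : (n : ℕ) → List (Vec (Fin 3) n)
allSeqs zero = [] ∷ []
allSeqs (suc n) = concatMap (λ a → map (a ∷_) (allSeqs n)) fin3

I₃ : ℕ → ℕ
I₃ n = length (filter admissible? (allSeqs n))

-- binomial with the convention C(r, -1) = 0 : binomPred r k = C(r, k-1)
binomPred : ℕ → ℕ → ℕ
binomPred r zero = 0
binomPred r (suc k) = r C k

pow2 : ℤ → ℚ
pow2 (+ m) = (+ (2 ^ m)) ℚ./ 1
pow2 -[1+ m ] = (+ 1) ℚ./ (2 ^ suc m)
  where instance _ = ℕₚ.m^n≢0 2 (suc m)

sumTo : ℕ → (ℕ → ℚ) → ℚ
sumTo zero f = f 0
sumTo (suc K) f = sumTo K f ℚ.+ f (suc K)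

term : ℕ → ℕ → ℚ
term n k = ((+ ((((n ∸ k) + 1) C k) + binomPred (n ∸ k) k)) ℚ./ 1)
           ℚ.* pow2 (+ n ℤ.- + (2 * k))

module Submission where

-- With Pell numbers P₀ = 0, P₁ = 1, P_{j+2} = 2P_{j+1} + P_j: a sequence counted by I₃ is a first
-- row followed by a shorter admissible sequence, so the numbers e(n), c(n) of admissible sequences
-- of length n + 1 starting in an outer row, resp. the middle row, obey e(n+1) = e(n) + c(n) and
-- c(n+1) = 2e(n) + c(n); hence e(n) = P_{n+1}, e(n) + c(n) = P_{n+2} and I₃(n+1) = P_{n+2} + P_{n+1}.
-- Pascal's rule shows that ∑ₖ C(m−k, k) 2^(m−2k) satisfies the Pell recurrence, so it equals P_{m+1}.
-- Twice the k-th summand of the corollary is the k-th summand of this sum for m = n + 1 plus the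
-- (k−1)-st one for m = n − 1, so twice the right-hand side is P_{n+2} + P_n = 2 I₃(n).

open import Defs
open import Data.Integer using (+_)
import Data.Rational as ℚ

open import Algebra.Bundles using (CommutativeMonoid)
open import Data.Fin using (Fin)
import Data.Fin as Fin
import Data.Integer as ℤ
import Data.Integer.Properties as ℤₚ
open import Data.List using (List; []; _∷_; _++_; length; filter; map; concatMap)
open import Data.List.Properties using (length-++; filter-++; map-cong; map-concatMap)
open import Data.Nat
open import Data.Nat.Combinatorics using (_C_; nCk+nC[k+1]≡[n+1]C[k+1]; k>n⇒nCk≡0)
open import Data.Nat.Coprimality using (1-coprimeTo) renaming (sym to Coprime-sym)
open import Data.Nat.DivMod using (m≡m%n+[m/n]*n; m%n<n; m/n*n≤m)
open import Data.Nat.ListAction using (sum)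
open import Data.Nat.Properties
open import Data.Nat.Tactic.RingSolver using (solve-∀)
open import Data.Product using (_×_; _,_; proj₁; proj₂)
open import Data.Rational using (ℚ; mkℚ)
import Data.Rational.Properties as ℚₚ
open import Data.Sum using (inj₁; inj₂)
open import Data.Vec using (Vec; _∷_)
open import Function using (_∘_)
open import Relation.Binary.PropositionalEquality
  using (_≡_; refl; sym; trans; cong; cong₂; subst; module ≡-Reasoning)
open import Relation.Nullary using (Dec; yes; no)

open import Algebra.Properties.CommutativeSemigroup +-commutativeSemigroup
  using () renaming (interchange to +-interchange)
open import Algebra.Properties.CommutativeSemigroup *-commutativeSemigroup
  using () renaming (x∙yz≈y∙xz to *-left-comm)
import Algebra.Properties.CommutativeSemigroup
  (CommutativeMonoid.commutativeSemigroup ℚₚ.*-1-commutativeMonoid) as ℚ-*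

∑< : ℕ → (ℕ → ℕ) → ℕ
∑< zero    g = 0
∑< (suc B) g = g 0 + ∑< B (g ∘ suc)

syntax ∑< B (λ k → e) = ∑[ k < B ] e

∑<-cong : ∀ B {g h : ℕ → ℕ} → (∀ k → g k ≡ h k) → ∑< B g ≡ ∑< B h
∑<-cong zero    g≡h = refl
∑<-cong (suc B) g≡h = cong₂ _+_ (g≡h 0) (∑<-cong B (g≡h ∘ suc))

∑<-zero : ∀ B → ∑[ k < B ] 0 ≡ 0
∑<-zero zero    = refl
∑<-zero (suc B) = ∑<-zero B

∑<-+ : ∀ B (g h : ℕ → ℕ) → ∑[ k < B ] (g k + h k) ≡ ∑< B g + ∑< B h
∑<-+ zero    g h = refl
∑<-+ (suc B) g h =
  trans (cong (_+_ (g 0 + h 0)) (∑<-+ B (g ∘ suc) (h ∘ suc))) (+-interchange (g 0) (h 0) _ _)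

∑<-*ˡ : ∀ B c (g : ℕ → ℕ) → ∑[ k < B ] (c * g k) ≡ c * ∑< B g
∑<-*ˡ zero    c g = sym (*-zeroʳ c)
∑<-*ˡ (suc B) c g = trans (cong (_+_ (c * g 0)) (∑<-*ˡ B c (g ∘ suc))) (sym (*-distribˡ-+ c (g 0) _))

∑<-snoc : ∀ B (g : ℕ → ℕ) → ∑< (suc B) g ≡ ∑< B g + g B
∑<-snoc zero    g = +-identityʳ (g 0)
∑<-snoc (suc B) g = trans (cong (_+_ (g 0)) (∑<-snoc B (g ∘ suc))) (sym (+-assoc (g 0) _ _))

-- pell m is the Pell number P_{m+1}.
pell : ℕ → ℕ
pell 0 = 1
pell 1 = 2
pell (suc (suc m)) = 2 * pell (suc m) + pell m

scaledBinomial : ℕ → ℕ → ℕ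
scaledBinomial a k = (a C k) * 2 ^ (a ∸ k)

scaledBinomial-suc-suc : ∀ a k →
  scaledBinomial (suc a) (suc k) ≡ 2 * scaledBinomial a (suc k) + scaledBinomial a k
scaledBinomial-suc-suc a k = begin
  (suc a C suc k) * 2 ^ (a ∸ k)
    ≡⟨ cong (_* 2 ^ (a ∸ k)) (nCk+nC[k+1]≡[n+1]C[k+1] a k) ⟨
  (a C k + a C suc k) * 2 ^ (a ∸ k)
    ≡⟨ *-distribʳ-+ (2 ^ (a ∸ k)) (a C k) (a C suc k) ⟩
  scaledBinomial a k + (a C suc k) * 2 ^ (a ∸ k)
    ≡⟨ cong (_+_ (scaledBinomial a k)) (doubling (k <? a)) ⟩
  scaledBinomial a k + 2 * scaledBinomial a (suc k)
    ≡⟨ +-comm (scaledBinomial a k) _ ⟩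
  2 * scaledBinomial a (suc k) + scaledBinomial a k
    ∎
  where
  open ≡-Reasoning
  -- For k ≥ a, 2^(a ∸ k) ≠ 2 · 2^(a ∸ (k+1)) because of truncation, but then C(a, k+1) = 0.
  doubling : Dec (k < a) → (a C suc k) * 2 ^ (a ∸ k) ≡ 2 * scaledBinomial a (suc k)
  doubling (yes k<a) rewrite +-∸-assoc 1 k<a = *-left-comm (a C suc k) 2 (2 ^ (a ∸ suc k))
  doubling (no k≮a) rewrite k>n⇒nCk≡0 (s≤s (≮⇒≥ k≮a)) = refl

pellSummand : ℕ → ℕ → ℕ
pellSummand m k = scaledBinomial (m ∸ k) k

pellSummand-suc-suc : ∀ m k →
  pellSummand (2 + m) (suc k) ≡ 2 * pellSummand (suc m) (suc k) + pellSummand m k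
pellSummand-suc-suc m k with k ≤? m
... | yes k≤m rewrite +-∸-assoc 1 k≤m = scaledBinomial-suc-suc (m ∸ k) k
... | no k≰m rewrite m≤n⇒m∸n≡0 (≰⇒> k≰m) | m≤n⇒m∸n≡0 (<⇒≤ (≰⇒> k≰m)) =
  sym (cong (_* 2 ^ (0 ∸ k)) (k>n⇒nCk≡0 (≤-trans (s≤s z≤n) (≰⇒> k≰m))))

∑pellSummand-suc-suc : ∀ B m →
  ∑[ k < suc B ] pellSummand (2 + m) k ≡
  2 * ∑[ k < suc B ] pellSummand (suc m) k + ∑[ k < B ] pellSummand m k
∑pellSummand-suc-suc B m = begin
  pellSummand (2 + m) 0 + ∑[ k < B ] pellSummand (2 + m) (suc k)
    ≡⟨ cong (_+_ (pellSummand (2 + m) 0)) (∑<-cong B (pellSummand-suc-suc m)) ⟩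
  pellSummand (2 + m) 0 + ∑[ k < B ] (2 * pellSummand (1 + m) (suc k) + pellSummand m k)
    ≡⟨ cong (_+_ (pellSummand (2 + m) 0)) (∑<-+ B _ (pellSummand m)) ⟩
  pellSummand (2 + m) 0 + (∑[ k < B ] (2 * pellSummand (1 + m) (suc k)) + ∑[ k < B ] pellSummand m k)
    ≡⟨ cong (λ s → pellSummand (2 + m) 0 + (s + ∑[ k < B ] pellSummand m k)) (∑<-*ˡ B 2 _) ⟩
  pellSummand (2 + m) 0 + (2 * ∑[ k < B ] pellSummand (1 + m) (suc k) + ∑[ k < B ] pellSummand m k)
    ≡⟨ regroup (2 ^ (1 + m)) _ _ ⟩
  2 * ∑[ k < suc B ] pellSummand (1 + m) k + ∑[ k < B ] pellSummand m k
    ∎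
  where
  open ≡-Reasoning
  regroup : ∀ x y z → 1 * (2 * x) + (2 * y + z) ≡ 2 * (1 * x + y) + z
  regroup = solve-∀

∑pellSummand≡pell : ∀ m B → m < 2 * B → ∑[ k < B ] pellSummand m k ≡ pell m
∑pellSummand≡pell 0 (suc B) _ = cong (_+_ 1) (trans (∑<-cong B (λ _ → refl)) (∑<-zero B))
∑pellSummand≡pell 1 (suc B) _ =
  cong (_+_ 2) (trans (∑<-cong B (λ k → cong (λ a → scaledBinomial a (suc k)) (0∸n≡0 k))) (∑<-zero B))
∑pellSummand≡pell (suc (suc m)) (suc B) 2+m<2+2B = begin
  ∑[ k < suc B ] pellSummand (2 + m) k
    ≡⟨ ∑pellSummand-suc-suc B m ⟩
  2 * ∑[ k < suc B ] pellSummand (1 + m) k + ∑[ k < B ] pellSummand m k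
    ≡⟨ cong₂ (λ x y → 2 * x + y) (∑pellSummand≡pell (suc m) (suc B) 1+m<2+2B) (∑pellSummand≡pell m B m<2B) ⟩
  2 * pell (1 + m) + pell m
    ∎
  where
  open ≡-Reasoning
  1+m<2+2B : suc m < 2 * suc B
  1+m<2+2B = ≤-trans (n≤1+n _) 2+m<2+2B
  m<2B : m < 2 * B
  m<2B = +-cancelˡ-< 2 m (2 * B) (subst (2 + m <_) (*-suc 2 B) 2+m<2+2B)

count : ∀ {n} → List (Vec (Fin 3) n) → ℕ
count xs = length (filter admissible? xs)

count-++ : ∀ {n} (xs ys : List (Vec (Fin 3) n)) → count (xs ++ ys) ≡ count xs + count ys
count-++ xs ys = trans (cong length (filter-++ admissible? xs ys)) (length-++ (filter admissible? xs))

count-concatMap : ∀ {n} {A : Set} (f : A → List (Vec (Fin 3) n)) (as : List A) →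
  count (concatMap f as) ≡ sum (map (count ∘ f) as)
count-concatMap f []       = refl
count-concatMap f (a ∷ as) = trans (count-++ (f a) _) (cong (_+_ (count (f a))) (count-concatMap f as))

adjacency : Fin 3 → Fin 3 → ℕ
adjacency a b with adjacent? a b
... | yes _ = 1
... | no _  = 0

count-∷-∷ : ∀ {n} a b (xs : List (Vec (Fin 3) n)) →
  count (map (a ∷_) (map (b ∷_) xs)) ≡ adjacency a b * count (map (b ∷_) xs)
count-∷-∷ a b []       = sym (*-zeroʳ (adjacency a b))
count-∷-∷ a b (v ∷ xs) with adjacent? a b | admissible? (b ∷ v) | count-∷-∷ a b xs
... | yes _ | yes _ | ih = cong suc ih
... | yes _ | no _  | ih = ih
... | no _  | _     | ih = ih

pathsFrom : ℕ → Fin 3 → ℕ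
pathsFrom n a = count (map (a ∷_) (allSeqs n))

pathsFrom-suc : ∀ n a → pathsFrom (suc n) a ≡ sum (map (λ b → adjacency a b * pathsFrom n b) fin3)
pathsFrom-suc n a = begin
  count (map (a ∷_) (concatMap (λ b → map (b ∷_) (allSeqs n)) fin3))
    ≡⟨ cong count (map-concatMap (a ∷_) (λ b → map (b ∷_) (allSeqs n)) fin3) ⟩
  count (concatMap (λ b → map (a ∷_) (map (b ∷_) (allSeqs n))) fin3)
    ≡⟨ count-concatMap (λ b → map (a ∷_) (map (b ∷_) (allSeqs n))) fin3 ⟩
  sum (map (λ b → count (map (a ∷_) (map (b ∷_) (allSeqs n)))) fin3)
    ≡⟨ cong sum (map-cong (λ b → count-∷-∷ a b (allSeqs n)) fin3) ⟩
  sum (map (λ b → adjacency a b * pathsFrom n b) fin3)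
    ∎
  where open ≡-Reasoning

I₃-suc : ∀ n → I₃ (suc n) ≡ sum (map (pathsFrom n) fin3)
I₃-suc n = count-concatMap (λ a → map (a ∷_) (allSeqs n)) fin3

row₁ row₂ row₃ : Fin 3
row₁ = Fin.zero
row₂ = Fin.suc Fin.zero
row₃ = Fin.suc (Fin.suc Fin.zero)

pathsFrom-pell : ∀ n →
  pathsFrom n row₁ ≡ pell n × pathsFrom n row₁ + pathsFrom n row₂ ≡ pell (suc n) × pathsFrom n row₃ ≡ pell n
pathsFrom-pell zero = refl , refl , refl
pathsFrom-pell (suc n) with pathsFrom-pell n
... | x≡ , x+y≡ , z≡ = x′≡ , x′+y′≡ , z′≡
  where
  open ≡-Reasoning
  x = pathsFrom n row₁
  y = pathsFrom n row₂
  z = pathsFrom n row₃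
  transfer₁ : ∀ x y z → 1 * x + (1 * y + (0 * z + 0)) ≡ x + y
  transfer₁ = solve-∀
  transfer₁₂ : ∀ x y z →
    (1 * x + (1 * y + (0 * z + 0))) + (1 * x + (1 * y + (1 * z + 0))) ≡ 2 * (x + y) + z
  transfer₁₂ = solve-∀
  transfer₃ : ∀ x y z → 0 * x + (1 * y + (1 * z + 0)) ≡ z + y
  transfer₃ = solve-∀
  x′≡ : pathsFrom (suc n) row₁ ≡ pell (suc n)
  x′≡ = begin
    pathsFrom (suc n) row₁         ≡⟨ pathsFrom-suc n row₁ ⟩
    1 * x + (1 * y + (0 * z + 0))  ≡⟨ transfer₁ x y z ⟩
    x + y                          ≡⟨ x+y≡ ⟩
    pell (suc n)                   ∎
  x′+y′≡ : pathsFrom (suc n) row₁ + pathsFrom (suc n) row₂ ≡ pell (2 + n)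
  x′+y′≡ = begin
    pathsFrom (suc n) row₁ + pathsFrom (suc n) row₂
      ≡⟨ cong₂ _+_ (pathsFrom-suc n row₁) (pathsFrom-suc n row₂) ⟩
    (1 * x + (1 * y + (0 * z + 0))) + (1 * x + (1 * y + (1 * z + 0)))
      ≡⟨ transfer₁₂ x y z ⟩
    2 * (x + y) + z
      ≡⟨ cong₂ (λ s t → 2 * s + t) x+y≡ z≡ ⟩
    2 * pell (suc n) + pell n
      ∎
  z′≡ : pathsFrom (suc n) row₃ ≡ pell (suc n)
  z′≡ = begin
    pathsFrom (suc n) row₃         ≡⟨ pathsFrom-suc n row₃ ⟩
    0 * x + (1 * y + (1 * z + 0))  ≡⟨ transfer₃ x y z ⟩
    z + y                          ≡⟨ cong (_+ y) (trans z≡ (sym x≡)) ⟩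
    x + y                          ≡⟨ x+y≡ ⟩
    pell (suc n)                   ∎

I₃-suc≡pell : ∀ n → I₃ (suc n) ≡ pell (suc n) + pell n
I₃-suc≡pell n with pathsFrom-pell n
... | _ , x+y≡ , z≡ = begin
  I₃ (suc n)              ≡⟨ I₃-suc n ⟩
  x + (y + (z + 0))       ≡⟨ regroup x y z ⟩
  (x + y) + z             ≡⟨ cong₂ _+_ x+y≡ z≡ ⟩
  pell (suc n) + pell n   ∎
  where
  open ≡-Reasoning
  x = pathsFrom n row₁
  y = pathsFrom n row₂
  z = pathsFrom n row₃
  regroup : ∀ x y z → x + (y + (z + 0)) ≡ (x + y) + z
  regroup = solve-∀

2*I₃-suc≡pell : ∀ n → 2 * I₃ (suc n) ≡ pell (2 + n) + pell n
2*I₃-suc≡pell n = trans (cong (2 *_) (I₃-suc≡pell n)) (double (pell (suc n)) (pell n))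
  where
  double : ∀ a b → 2 * (a + b) ≡ (2 * a + b) + b
  double = solve-∀

ι : ℕ → ℚ
ι n = + n ℚ./ 1

ι≡mkℚ : ∀ n → ι n ≡ mkℚ (+ n) 0 (Coprime-sym (1-coprimeTo n))
ι≡mkℚ n = ℚₚ.normalize-coprime (Coprime-sym (1-coprimeTo n))

ι-+ : ∀ a b → ι a ℚ.+ ι b ≡ ι (a + b)
ι-+ a b = trans (cong₂ ℚ._+_ (ι≡mkℚ a) (ι≡mkℚ b))
  (cong (ℚ._/ 1) (cong₂ ℤ._+_ (ℤₚ.*-identityʳ (+ a)) (ℤₚ.*-identityʳ (+ b))))

ι-* : ∀ a b → ι a ℚ.* ι b ≡ ι (a * b)
ι-* a b = trans (cong₂ ℚ._*_ (ι≡mkℚ a) (ι≡mkℚ b)) (cong (ℚ._/ 1) (sym (ℤₚ.pos-* a b)))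

ι2*-injective : ∀ {p q} → ι 2 ℚ.* p ≡ ι 2 ℚ.* q → p ≡ q
ι2*-injective {p} {q} 2p≡2q = begin
  p                     ≡⟨ ℚₚ.*-identityˡ p ⟨
  ℚ.½ ℚ.* ι 2 ℚ.* p     ≡⟨ ℚₚ.*-assoc ℚ.½ (ι 2) p ⟩
  ℚ.½ ℚ.* (ι 2 ℚ.* p)   ≡⟨ cong (ℚ.½ ℚ.*_) 2p≡2q ⟩
  ℚ.½ ℚ.* (ι 2 ℚ.* q)   ≡⟨ ℚₚ.*-assoc ℚ.½ (ι 2) q ⟨
  ℚ.½ ℚ.* ι 2 ℚ.* q     ≡⟨ ℚₚ.*-identityˡ q ⟩
  q                     ∎
  where open ≡-Reasoning

-- The only negative exponent allowed by the hypothesis is −1, at 2k = n + 1.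
ι2*pow2 : ∀ n k → 2 * k ≤ suc n → ι 2 ℚ.* pow2 (+ n ℤ.- + (2 * k)) ≡ ι (2 ^ (suc n ∸ 2 * k))
ι2*pow2 n k 2k≤1+n with m≤n⇒m<n∨m≡n 2k≤1+n
... | inj₁ (s≤s 2k≤n) rewrite ℤₚ.m-n≡m⊖n n (2 * k) | ℤₚ.⊖-≥ 2k≤n | +-∸-assoc 1 2k≤n =
  ι-* 2 (2 ^ (n ∸ 2 * k))
... | inj₂ 2k≡1+n rewrite 2k≡1+n | ℤₚ.m-n≡m⊖n n (suc n) | ℤₚ.⊖-< (n<1+n n) | m+n∸n≡m 1 n | n∸n≡0 n =
  refl

ι2*sumTo : ∀ K (g : ℕ → ℚ) (h : ℕ → ℕ) → (∀ k → k ≤ K → ι 2 ℚ.* g k ≡ ι (h k)) →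
  ι 2 ℚ.* sumTo K g ≡ ι (∑< (suc K) h)
ι2*sumTo zero    g h 2g≡h = trans (2g≡h 0 z≤n) (cong ι (sym (+-identityʳ (h 0))))
ι2*sumTo (suc K) g h 2g≡h = begin
  ι 2 ℚ.* (sumTo K g ℚ.+ g (suc K))        ≡⟨ ℚₚ.*-distribˡ-+ (ι 2) (sumTo K g) (g (suc K)) ⟩
  ι 2 ℚ.* sumTo K g ℚ.+ ι 2 ℚ.* g (suc K)
    ≡⟨ cong₂ ℚ._+_ (ι2*sumTo K g h (λ k k≤K → 2g≡h k (m≤n⇒m≤1+n k≤K))) (2g≡h (suc K) ≤-refl) ⟩
  ι (∑< (suc K) h) ℚ.+ ι (h (suc K))       ≡⟨ ι-+ (∑< (suc K) h) (h (suc K)) ⟩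
  ι (∑< (suc K) h + h (suc K))             ≡⟨ cong ι (∑<-snoc (suc K) h) ⟨
  ι (∑< (suc (suc K)) h)                   ∎
  where open ≡-Reasoning

pellSummandPred : ℕ → ℕ → ℕ
pellSummandPred m zero    = 0
pellSummandPred m (suc k) = pellSummand m k

∸-∸≡∸2* : ∀ m k → m ∸ k ∸ k ≡ m ∸ 2 * k
∸-∸≡∸2* m k = trans (∸-+-assoc m k k) (cong (λ t → m ∸ (k + t)) (sym (+-identityʳ k)))

2*k≤2+m⇒k≤1+m : ∀ {k m} → 2 * k ≤ 2 + m → k ≤ 1 + m
2*k≤2+m⇒k≤1+m {zero}      _      = z≤n
2*k≤2+m⇒k≤1+m {suc j} {m} 2k≤2+m =
  s≤s (≤-trans (m≤m+n j (j + 0)) (s≤s⁻¹ (s≤s⁻¹ (subst (_≤ 2 + m) (*-suc 2 j) 2k≤2+m))))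

doubled-coefficient : ∀ m k → k ≤ suc m →
  (((suc m ∸ k) + 1) C k + binomPred (suc m ∸ k) k) * 2 ^ (2 + m ∸ 2 * k)
    ≡ pellSummand (2 + m) k + pellSummandPred m k
doubled-coefficient m k k≤1+m =
  trans (*-distribʳ-+ (2 ^ (2 + m ∸ 2 * k)) (((suc m ∸ k) + 1) C k) (binomPred (suc m ∸ k) k))
        (cong₂ _+_ shifted (pred-part k))
  where
  shifted : (((suc m ∸ k) + 1) C k) * 2 ^ (2 + m ∸ 2 * k) ≡ pellSummand (2 + m) k
  shifted = cong₂ (λ a e → (a C k) * 2 ^ e)
    (trans (+-comm _ 1) (sym (+-∸-assoc 1 k≤1+m))) (sym (∸-∸≡∸2* (2 + m) k))
  pred-part : ∀ k → binomPred (suc m ∸ k) k * 2 ^ (2 + m ∸ 2 * k) ≡ pellSummandPred m k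
  pred-part zero    = refl
  pred-part (suc j) = cong (((m ∸ j) C j) *_)
    (cong (2 ^_) (trans (cong (2 + m ∸_) (*-suc 2 j)) (sym (∸-∸≡∸2* m j))))

doubled-term : ∀ m k → 2 * k ≤ 2 + m →
  ι 2 ℚ.* term (suc m) k ≡ ι (pellSummand (2 + m) k + pellSummandPred m k)
doubled-term m k 2k≤2+m = begin
  ι 2 ℚ.* (ι c ℚ.* pow2 e)           ≡⟨ ℚ-*.x∙yz≈y∙xz (ι 2) (ι c) (pow2 e) ⟩
  ι c ℚ.* (ι 2 ℚ.* pow2 e)           ≡⟨ cong (ι c ℚ.*_) (ι2*pow2 (suc m) k 2k≤2+m) ⟩
  ι c ℚ.* ι (2 ^ (2 + m ∸ 2 * k))    ≡⟨ ι-* c _ ⟩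
  ι (c * 2 ^ (2 + m ∸ 2 * k))        ≡⟨ cong ι (doubled-coefficient m k (2*k≤2+m⇒k≤1+m 2k≤2+m)) ⟩
  ι (pellSummand (2 + m) k + pellSummandPred m k) ∎
  where
  open ≡-Reasoning
  c = ((suc m ∸ k) + 1) C k + binomPred (suc m ∸ k) k
  e = + suc m ℤ.- + (2 * k)

half-bounds : ∀ x → 2 * (x / 2) ≤ x × x ≤ suc (2 * (x / 2))
half-bounds x =
  ≤-trans (≤-reflexive (*-comm 2 (x / 2))) (m/n*n≤m x 2) ,
  ≤-trans (≤-reflexive (m≡m%n+[m/n]*n x 2)) (+-mono-≤ (s≤s⁻¹ (m%n<n x 2)) (≤-reflexive (*-comm (x / 2) 2)))

corollary3p3 : (n : ℕ) → .{{_ : NonZero n}} →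
    (+ I₃ n) ℚ./ 1 ≡ sumTo ((n + 1) / 2) (term n)
corollary3p3 (suc m) = ι2*-injective (begin
  ι 2 ℚ.* ι (I₃ (suc m))
    ≡⟨ ι-* 2 (I₃ (suc m)) ⟩
  ι (2 * I₃ (suc m))
    ≡⟨ cong ι (2*I₃-suc≡pell m) ⟩
  ι (pell (2 + m) + pell m)
    ≡⟨ cong ι (cong₂ _+_ (∑pellSummand≡pell (2 + m) (suc K) 2+m<2+2K) (∑pellSummand≡pell m K m<2K)) ⟨
  ι (∑[ k < suc K ] pellSummand (2 + m) k + ∑[ k < suc K ] pellSummandPred m k)
    ≡⟨ cong ι (∑<-+ (suc K) (pellSummand (2 + m)) (pellSummandPred m)) ⟨
  ι (∑[ k < suc K ] (pellSummand (2 + m) k + pellSummandPred m k))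
    ≡⟨ ι2*sumTo K (term (suc m)) (λ k → pellSummand (2 + m) k + pellSummandPred m k)
                  (λ k k≤K → doubled-term m k (≤-trans (*-monoʳ-≤ 2 k≤K) 2K≤2+m)) ⟨
  ι 2 ℚ.* sumTo K (term (suc m))
    ∎)
  where
  open ≡-Reasoning
  K = (suc m + 1) / 2
  1+m+1≡2+m : suc m + 1 ≡ 2 + m
  1+m+1≡2+m = cong suc (+-comm m 1)
  2K≤2+m : 2 * K ≤ 2 + m
  2K≤2+m = subst (2 * K ≤_) 1+m+1≡2+m (proj₁ (half-bounds (suc m + 1)))
  m<2K : m < 2 * K
  m<2K = s≤s⁻¹ (subst (_≤ suc (2 * K)) 1+m+1≡2+m (proj₂ (half-bounds (suc m + 1))))
  2+m<2+2K : 2 + m < 2 * suc K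
  2+m<2+2K = subst (2 + m <_) (sym (*-suc 2 K)) (s≤s (s≤s m<2K))
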